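{- Let $n$ be a positive integer and $x\in\mathbb{C}$ with $x\neq -n$ and $x\neq 1-n$. Then \[ \sum_{k=1}^n(-1)^k\binom{x+n}{k}kH_{k}=\frac{(-1)^n n x}{x+n-1}\binom{x+n}{n}\left\{H_{n}+\frac{n^2+(n-1)(x-1)}{n(x+n)(x+n-1)}\right\}+\frac{1}{x+n-1}. \]
   Context: $H_0=0$ and $H_m=\sum_{j=1}^m \frac1j$ for $m\ge1$. For $z\in\mathbb{C}$ and $k\in\mathbb{N}_0$, $\binom{z}{k}=\frac{z(z-1)\cdots(z-k+1)}{k!}$. -}

module Defs where

open import Level using (Level; suc; _⊔_)
open import Algebra.Bundles using (CommutativeRing)
open import Data.Nat using (ℕ; zero) renaming (suc to 1+)
open import Data.Nat.Combinatorics using ()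
open import Data.Nat.Base using (_!)
open import Relation.Nullary using (¬_)
open import Relation.Binary.PropositionalEquality using (_≡_)

embed : {c ℓ : Level} (R : CommutativeRing c ℓ) → ℕ → CommutativeRing.Carrier R
embed R zero   = CommutativeRing.0# R
embed R (1+ n) = CommutativeRing._+_ R (CommutativeRing.1# R) (embed R n)

-- A field of characteristic zero (ℂ is one).  The inverse is a total
-- function, only constrained on nonzero elements (as in Lean/Mathlib).
record CharZeroField (c ℓ : Level) : Set (suc (c ⊔ ℓ)) where
  field
    commutativeRing : CommutativeRing c ℓ
  open CommutativeRing commutativeRing public
  field
    _⁻¹       : Carrier → Carrier
    ⁻¹-cong   : ∀ {x y} → x ≈ y → x ⁻¹ ≈ y ⁻¹
    inverseʳ  : ∀ x → ¬ (x ≈ 0#) → x * (x ⁻¹) ≈ 1#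
    charZero  : ∀ n → embed commutativeRing n ≈ 0# → n ≡ 0
  ι : ℕ → Carrier
  ι = embed commutativeRing

module FieldDefs {c ℓ : Level} (F : CharZeroField c ℓ) where
  open CharZeroField F

  Σ₁ : ℕ → (ℕ → Carrier) → Carrier
  Σ₁ zero   f = 0#
  Σ₁ (1+ n) f = Σ₁ n f + f (1+ n)

  H : ℕ → Carrier
  H m = Σ₁ m (λ j → ι j ⁻¹)

  sgn : ℕ → Carrier
  sgn zero   = 1#
  sgn (1+ k) = - sgn k

  falling : Carrier → ℕ → Carrier
  falling z zero   = 1#
  falling z (1+ k) = falling z k * (z - ι k)

  binom : Carrier → ℕ → Carrier
  binom z k = falling z k * (ι (k !) ⁻¹)

-- Multiplying the closed form by z (z - 1)² removes every inverse except the 1/k hidden in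
-- C(z,k) and Hₖ.  Those are handled by the absorption identity (z - n) C(z,n) = (n+1) C(z,n+1)
-- and by (n+1) Hₙ₊₁ = (n+1) Hₙ + 1, after which the induction step on n is a polynomial
-- identity.  The corollary is the case z = x + n, where x ≠ -n and x ≠ 1 - n say that
-- z ≠ 0 and z ≠ 1, so that one may divide by z (z - 1)² again.

module Submission where

open import Defs
open import Level using (Level)
open import Data.Nat using (ℕ; _≥_; _∸_)
open import Relation.Nullary using (¬_)

open import Algebra.Bundles using (CommutativeRing)
open import Algebra.Solver.Ring.AlmostCommutativeRing
  using (fromCommutativeRing; _-Raw-AlmostCommutative⟶_)
open import Data.Integer.Base as ℤ using (ℤ; +_; -[1+_]; _⊖_; _◃_)
open import Data.Integer.Properties as ℤ
  using ([1+m]⊖[1+n]≡m⊖n; +◃n≡+n; -◃n≡-n)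
open import Data.Maybe.Base using (Maybe; map)
open import Data.Nat.Base as ℕ using (zero; suc; s≤s; z≤n; _!)
open import Data.Nat.Properties using (+-suc; _!≢0)
open import Data.Sign.Base as Sign using ()
open import Relation.Binary.Consequences using (dec⇒weaklyDec)
import Relation.Binary.PropositionalEquality as ≡

module IntegerCoefficientRingSolver {c ℓ : Level} (R : CommutativeRing c ℓ) where
  open CommutativeRing R
  open import Algebra.Properties.Ring ring
    using (-‿involutive; -0#≈0#; -‿distribˡ-*; -‿distribʳ-*)
  open import Algebra.Properties.AbelianGroup +-abelianGroup using (⁻¹-∙-comm)
  open import Algebra.Properties.CommutativeSemigroup +-commutativeSemigroup
    using (interchange)
  open import Algebra.Properties.Semiring.Mult.TCOptimised semiring
    using (_×_; 1+×; ×-homo-+; ×1-homo-*)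
  open import Relation.Binary.Reasoning.Setoid setoid

  -- The optimised _×_ has 1 × x = x, so that con (+ 1) denotes 1# itself and the
  -- equations produced by the solver match goals written with 1#.
  ⟦_⟧ : ℤ → Carrier
  ⟦ + n ⟧      = n × 1#
  ⟦ -[1+ n ] ⟧ = - (suc n × 1#)

  ⊖-homo : ∀ m n → ⟦ m ⊖ n ⟧ ≈ m × 1# - n × 1#
  ⊖-homo zero    zero    = sym (-‿inverseʳ 0#)
  ⊖-homo zero    (suc n) = sym (+-identityˡ _)
  ⊖-homo (suc m) zero    = sym (trans (+-congˡ -0#≈0#) (+-identityʳ _))
  ⊖-homo (suc m) (suc n) = begin
    ⟦ suc m ⊖ suc n ⟧             ≡⟨ ≡.cong ⟦_⟧ ([1+m]⊖[1+n]≡m⊖n m n) ⟩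
    ⟦ m ⊖ n ⟧                     ≈⟨ ⊖-homo m n ⟩
    M - N                         ≈⟨ +-identityˡ (M - N) ⟨
    0# + (M - N)                  ≈⟨ +-congʳ (-‿inverseʳ 1#) ⟨
    (1# - 1#) + (M - N)           ≈⟨ interchange 1# (- 1#) M (- N) ⟩
    (1# + M) + (- 1# - N)         ≈⟨ +-congˡ (⁻¹-∙-comm 1# N) ⟩
    (1# + M) - (1# + N)           ≈⟨ +-cong (1+× m 1#) (-‿cong (1+× n 1#)) ⟨
    suc m × 1# - suc n × 1#       ∎
    where M = m × 1#; N = n × 1#

  -‿homo : ∀ i → ⟦ ℤ.- i ⟧ ≈ - ⟦ i ⟧
  -‿homo (+ zero)  = sym -0#≈0#
  -‿homo (+ suc n) = refl
  -‿homo -[1+ n ]  = sym (-‿involutive _)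

  +-homo : ∀ i j → ⟦ i ℤ.+ j ⟧ ≈ ⟦ i ⟧ + ⟦ j ⟧
  +-homo -[1+ m ] -[1+ n ] = begin
    - (suc (suc (m ℕ.+ n)) × 1#)     ≡⟨ ≡.cong (λ k → - (k × 1#)) (+-suc (suc m) n) ⟨
    - ((suc m ℕ.+ suc n) × 1#)       ≈⟨ -‿cong (×-homo-+ 1# (suc m) (suc n)) ⟩
    - (suc m × 1# + suc n × 1#)      ≈⟨ ⁻¹-∙-comm _ _ ⟨
    - (suc m × 1#) - (suc n × 1#)    ∎
  +-homo -[1+ m ] (+ n)    = trans (⊖-homo n (suc m)) (+-comm _ _)
  +-homo (+ m)    -[1+ n ] = ⊖-homo m (suc n)
  +-homo (+ m)    (+ n)    = ×-homo-+ 1# m n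

  -◃-homo : ∀ n → ⟦ Sign.- ◃ n ⟧ ≈ - (n × 1#)
  -◃-homo n = trans (reflexive (≡.cong ⟦_⟧ (-◃n≡-n n))) (-‿homo (+ n))

  +◃-homo : ∀ n → ⟦ Sign.+ ◃ n ⟧ ≈ n × 1#
  +◃-homo n = reflexive (≡.cong ⟦_⟧ (+◃n≡+n n))

  *-homo : ∀ i j → ⟦ i ℤ.* j ⟧ ≈ ⟦ i ⟧ * ⟦ j ⟧
  *-homo (+ m)    (+ n)    = trans (+◃-homo (m ℕ.* n)) (×1-homo-* m n)
  *-homo (+ m)    -[1+ n ] = trans (-◃-homo (m ℕ.* suc n))
    (trans (-‿cong (×1-homo-* m (suc n))) (-‿distribʳ-* _ _))
  *-homo -[1+ m ] (+ n)    = trans (-◃-homo (suc m ℕ.* n))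
    (trans (-‿cong (×1-homo-* (suc m) n)) (-‿distribˡ-* _ _))
  *-homo -[1+ m ] -[1+ n ] = begin
    ⟦ Sign.+ ◃ (suc m ℕ.* suc n) ⟧   ≈⟨ +◃-homo (suc m ℕ.* suc n) ⟩
    (suc m ℕ.* suc n) × 1#            ≈⟨ ×1-homo-* (suc m) (suc n) ⟩
    M * N                             ≈⟨ -‿involutive (M * N) ⟨
    - - (M * N)                       ≈⟨ -‿cong (-‿distribʳ-* M N) ⟩
    - (M * - N)                       ≈⟨ -‿distribˡ-* M (- N) ⟩
    - M * - N                         ∎
    where M = suc m × 1#; N = suc n × 1#

  homomorphism : ℤ.+-*-rawRing -Raw-AlmostCommutative⟶ fromCommutativeRing R
  homomorphism = record
    { ⟦_⟧    = ⟦_⟧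
    ; +-homo = +-homo
    ; *-homo = *-homo
    ; -‿homo = -‿homo
    ; 0-homo = refl
    ; 1-homo = refl
    }

  coefficients≟ : ∀ i j → Maybe (⟦ i ⟧ ≈ ⟦ j ⟧)
  coefficients≟ i j = map (λ { ≡.refl → refl }) (dec⇒weaklyDec ℤ._≟_ i j)

  open import Algebra.Solver.Ring ℤ.+-*-rawRing (fromCommutativeRing R) homomorphism coefficients≟
    public using (Polynomial; solve; _:=_; _:+_; _:*_; _:-_; :-_; con)

module CharZeroFieldProperties {c ℓ : Level} (F : CharZeroField c ℓ) where
  open CharZeroField F hiding (zero)
  open import Algebra.Properties.CommutativeSemigroup *-commutativeSemigroup
    using (x∙yz≈yx∙z)
  open import Algebra.Properties.Semiring.Mult semiring using (_×_; ×1-homo-*)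
  open import Relation.Binary.Reasoning.Setoid setoid

  ι≡×1# : ∀ n → ι n ≡.≡ n × 1#
  ι≡×1# zero    = ≡.refl
  ι≡×1# (suc n) = ≡.cong (_+_ 1#) (ι≡×1# n)

  ι-* : ∀ m n → ι (m ℕ.* n) ≈ ι m * ι n
  ι-* m n = begin
    ι (m ℕ.* n)           ≡⟨ ι≡×1# (m ℕ.* n) ⟩
    (m ℕ.* n) × 1#        ≈⟨ ×1-homo-* m n ⟩
    (m × 1#) * (n × 1#)   ≡⟨ ≡.cong₂ _*_ (ι≡×1# m) (ι≡×1# n) ⟨
    ι m * ι n             ∎

  ι-nonzero : ∀ n → .{{ℕ.NonZero n}} → ¬ ι n ≈ 0#
  ι-nonzero n ιn≈0 = ℕ.≢-nonZero⁻¹ n (charZero n ιn≈0)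

  x⁻¹*[x*y]≈y : ∀ {x} y → ¬ x ≈ 0# → x ⁻¹ * (x * y) ≈ y
  x⁻¹*[x*y]≈y {x} y x≉0 = begin
    x ⁻¹ * (x * y)  ≈⟨ *-assoc _ _ _ ⟨
    x ⁻¹ * x * y    ≈⟨ *-congʳ (trans (*-comm _ _) (inverseʳ x x≉0)) ⟩
    1# * y          ≈⟨ *-identityˡ y ⟩
    y               ∎

  *-cancelˡ : ∀ {x y z} → ¬ x ≈ 0# → x * y ≈ x * z → y ≈ z
  *-cancelˡ {x} {y} {z} x≉0 xy≈xz = begin
    y               ≈⟨ x⁻¹*[x*y]≈y y x≉0 ⟨
    x ⁻¹ * (x * y)  ≈⟨ *-congˡ xy≈xz ⟩
    x ⁻¹ * (x * z)  ≈⟨ x⁻¹*[x*y]≈y z x≉0 ⟩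
    z               ∎

  *-nonzero : ∀ {x y} → ¬ x ≈ 0# → ¬ y ≈ 0# → ¬ x * y ≈ 0#
  *-nonzero {x} {y} x≉0 y≉0 xy≈0 = y≉0 (*-cancelˡ x≉0 (trans xy≈0 (sym (zeroʳ x))))

  inverseʳ-unique : ∀ {x y} → ¬ x ≈ 0# → x * y ≈ 1# → y ≈ x ⁻¹
  inverseʳ-unique {x} {y} x≉0 xy≈1 =
    *-cancelˡ x≉0 (trans xy≈1 (sym (inverseʳ x x≉0)))

  x*[x*y]⁻¹≈y⁻¹ : ∀ {x y} → ¬ x ≈ 0# → ¬ y ≈ 0# → x * (x * y) ⁻¹ ≈ y ⁻¹
  x*[x*y]⁻¹≈y⁻¹ {x} {y} x≉0 y≉0 = inverseʳ-unique y≉0 (begin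
    y * (x * (x * y) ⁻¹)  ≈⟨ x∙yz≈yx∙z y x _ ⟩
    x * y * (x * y) ⁻¹    ≈⟨ inverseʳ (x * y) (*-nonzero x≉0 y≉0) ⟩
    1#                    ∎)

module AlternatingBinomialHarmonicSum {c ℓ : Level} (F : CharZeroField c ℓ) where
  open CharZeroField F hiding (zero)
  open FieldDefs F
  open CharZeroFieldProperties F
  open IntegerCoefficientRingSolver commutativeRing
  open import Algebra.Properties.CommutativeSemigroup *-commutativeSemigroup
    using (xy∙z≈xz∙y; x∙yz≈y∙xz)
  open import Relation.Binary.Reasoning.Setoid setoid

  binom-zero : ∀ z → binom z 0 ≈ 1#
  binom-zero z = trans (*-identityˡ _)
    (sym (inverseʳ-unique (ι-nonzero 1) (trans (*-identityʳ (ι 1)) (+-identityʳ 1#))))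

  binom-absorption : ∀ z k → binom z k * (z - ι k) ≈ ι (suc k) * binom z (suc k)
  binom-absorption z k = begin
    f * g ⁻¹ * d                  ≈⟨ xy∙z≈xz∙y f (g ⁻¹) d ⟩
    f * d * g ⁻¹                  ≈⟨ *-congˡ (x*[x*y]⁻¹≈y⁻¹ (ι-nonzero (suc k)) (ι-nonzero (k !) {{k !≢0}})) ⟨
    f * d * (p * (p * g) ⁻¹)      ≈⟨ *-congˡ (*-congˡ (⁻¹-cong (ι-* (suc k) (k !)))) ⟨
    f * d * (p * ι (suc k !) ⁻¹)  ≈⟨ x∙yz≈y∙xz (f * d) p _ ⟩
    p * (f * d * ι (suc k !) ⁻¹)  ∎
    where f = falling z k; d = z - ι k; g = ι (k !); p = ι (suc k)

  H-suc : ∀ k → ι (suc k) * H (suc k) ≈ ι (suc k) * H k + 1#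
  H-suc k = trans (distribˡ _ _ _) (+-congˡ (inverseʳ (ι (suc k)) (ι-nonzero (suc k))))

  -- With s = (-1)ⁿ, b = C(z,n)(z-n), m = n and h = n Hₙ this is z (z-1)² Σₖ (-1)ᵏ C(z,k) k Hₖ.
  Φ : (s b m h z : Carrier) → Carrier
  Φ s b m h z = s * b * (z * (z - 1#) * h + (m * z - z + 1#)) + z * (z - 1#)

  Φ-expr : ∀ {k} (s b m h z : Polynomial k) → Polynomial k
  Φ-expr s b m h z = s :* b :* (z :* (z :- I) :* h :+ (m :* z :- z :+ I)) :+ z :* (z :- I)
    where I = con (+ 1)

  closedForm : Carrier → ℕ → Carrier
  closedForm z n = Φ (sgn n) (binom z n * (z - ι n)) (ι n) (ι n * H n) z

  Φ-base : ∀ z → 0# ≈ Φ 1# (1# * (z - 0#)) 0# (0# * 0#) z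
  Φ-base = solve 1 (λ z → O := Φ-expr I (I :* (z :- O)) O (O :* O) z) refl
    where I = con (+ 1); O = con (+ 0)

  Φ-step : ∀ s b m h z →
    Φ s ((1# + m) * b) m (m * h) z + z * (z - 1#) * (z - 1#) * (- s * b * ((1# + m) * h + 1#))
      ≈ Φ (- s) (b * (z - (1# + m))) (1# + m) ((1# + m) * h + 1#) z
  Φ-step = solve 5 (λ s b m h z →
    Φ-expr s ((I :+ m) :* b) m (m :* h) z
      :+ z :* (z :- I) :* (z :- I) :* (:- s :* b :* ((I :+ m) :* h :+ I))
    := Φ-expr (:- s) (b :* (z :- (I :+ m))) (I :+ m) ((I :+ m) :* h :+ I) z) refl
    where I = con (+ 1)

  scaled-sum-closedForm : ∀ z n →
    z * (z - 1#) * (z - 1#) * Σ₁ n (λ k → sgn k * binom z k * ι k * H k) ≈ closedForm z n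
  scaled-sum-closedForm z zero = begin
    z * (z - 1#) * (z - 1#) * 0#          ≈⟨ zeroʳ _ ⟩
    0#                                    ≈⟨ Φ-base z ⟩
    Φ 1# (1# * (z - 0#)) 0# (0# * 0#) z   ≈⟨ +-congʳ (*-congʳ (*-congˡ (*-congʳ (binom-zero z)))) ⟨
    closedForm z zero                     ∎
  scaled-sum-closedForm z (suc n) = begin
    D * (S + s′ * b′ * p * H (suc n))            ≈⟨ distribˡ D _ _ ⟩
    D * S + D * (s′ * b′ * p * H (suc n))        ≈⟨ +-cong (scaled-sum-closedForm z n) (*-congˡ last-term) ⟩
    closedForm z n + D * (s′ * b′ * (p * H n + 1#))
      ≈⟨ +-congʳ (+-congʳ (*-congʳ (*-congˡ (binom-absorption z n)))) ⟩
    Φ s (p * b′) m (m * H n) z + D * (s′ * b′ * (p * H n + 1#))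
      ≈⟨ Φ-step s b′ m (H n) z ⟩
    Φ s′ (b′ * (z - p)) p (p * H n + 1#) z       ≈⟨ +-congʳ (*-congˡ (+-congʳ (*-congˡ (H-suc n)))) ⟨
    closedForm z (suc n)                          ∎
    where
    D = z * (z - 1#) * (z - 1#)
    S = Σ₁ n (λ k → sgn k * binom z k * ι k * H k)
    s = sgn n
    s′ = sgn (suc n)
    b′ = binom z (suc n)
    m = ι n
    p = ι (suc n)
    last-term : s′ * b′ * p * H (suc n) ≈ s′ * b′ * (p * H n + 1#)
    last-term = trans (*-assoc _ _ _) (*-congˡ (H-suc n))

  sum-closedForm : ∀ z n .{{_ : ℕ.NonZero n}} → ¬ z ≈ 0# → ¬ z - 1# ≈ 0# →
    Σ₁ n (λ k → sgn k * binom z k * ι k * H k)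
      ≈ sgn n * ι n * (z - ι n) * (z - 1#) ⁻¹ * binom z n
          * (H n + (ι n * z - z + 1#) * (ι n * z * (z - 1#)) ⁻¹)
        + (z - 1#) ⁻¹
  sum-closedForm z n z≉0 z-1≉0 = *-cancelˡ (*-nonzero (*-nonzero z≉0 z-1≉0) z-1≉0) (begin
    D * Σ₁ n (λ k → sgn k * binom z k * ι k * H k)  ≈⟨ scaled-sum-closedForm z n ⟩
    closedForm z n                                    ≈⟨ Ψ-at-one (inverseʳ _ z-1≉0) (inverseʳ _ a≉0) ⟨
    Ψ ((z - 1#) * u) (a * v)                          ≈⟨ scaled-formula ⟨
    D * (s * m * (z - m) * u * b * (h + (m * z - z + 1#) * v) + u) ∎)
    where
    D = z * (z - 1#) * (z - 1#)
    m = ι n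
    a = m * z * (z - 1#)
    u = (z - 1#) ⁻¹
    v = a ⁻¹
    s = sgn n
    b = binom z n
    h = H n

    a≉0 : ¬ a ≈ 0#
    a≉0 = *-nonzero (*-nonzero (ι-nonzero n) z≉0) z-1≉0

    Ψ : Carrier → Carrier → Carrier
    Ψ U V = s * (b * (z - m)) * (z * (z - 1#) * (m * h) * U + (m * z - z + 1#) * U * V)
            + z * (z - 1#) * U

    Ψ-at-one : ∀ {U V} → U ≈ 1# → V ≈ 1# → Ψ U V ≈ closedForm z n
    Ψ-at-one U≈1 V≈1 =
      +-cong (*-congˡ (+-cong (drop U≈1) (trans (*-cong (drop U≈1) V≈1) (*-identityʳ _)))) (drop U≈1)
      where
      drop : ∀ {y W} → W ≈ 1# → y * W ≈ y
      drop W≈1 = trans (*-congˡ W≈1) (*-identityʳ _)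

    scaled-formula : D * (s * m * (z - m) * u * b * (h + (m * z - z + 1#) * v) + u)
                       ≈ Ψ ((z - 1#) * u) (a * v)
    scaled-formula = solve 7 (λ s b z m h u v →
        z :* (z :- I) :* (z :- I)
          :* (s :* m :* (z :- m) :* u :* b :* (h :+ (m :* z :- z :+ I) :* v) :+ u)
        := s :* (b :* (z :- m)) :* (z :* (z :- I) :* (m :* h) :* ((z :- I) :* u)
                                   :+ (m :* z :- z :+ I) :* ((z :- I) :* u) :* (m :* z :* (z :- I) :* v))
           :+ z :* (z :- I) :* ((z :- I) :* u))
      refl s b z m h u v
      where I = con (+ 1)

corollary5 : {c ℓ : Level} (F : CharZeroField c ℓ) →
    let open CharZeroField F in
    let open FieldDefs F in
    (n : ℕ) → n ≥ 1 → (x : Carrier) →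
    ¬ (x ≈ - ι n) → ¬ (x ≈ 1# - ι n) →
    Σ₁ n (λ k → sgn k * binom (x + ι n) k * ι k * H k)
      ≈ sgn n * ι n * x * ((x + ι n - 1#) ⁻¹) * binom (x + ι n) n
          * (H n + (ι n * ι n + ι (n ∸ 1) * (x - 1#))
                   * ((ι n * (x + ι n) * (x + ι n - 1#)) ⁻¹))
        + (x + ι n - 1#) ⁻¹
corollary5 F n@(suc n′) (s≤s z≤n) x x≉-n x≉1-n =
  trans (sum-closedForm z n z≉0 z-1≉0)
    (+-congʳ (*-cong (*-congʳ (*-congʳ (*-congˡ (//-rightDividesʳ (ι n) x))))
                     (+-congˡ (*-congʳ numerator-shift))))
  where
  open CharZeroField F hiding (zero)
  open FieldDefs F
  open AlternatingBinomialHarmonicSum F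
  open IntegerCoefficientRingSolver commutativeRing
  open import Algebra.Properties.Group +-group
    using (inverseˡ-unique; x∙y⁻¹≈ε⇒x≈y; //-rightDividesʳ)

  z = x + ι n

  z≉0 : ¬ z ≈ 0#
  z≉0 z≈0 = x≉-n (inverseˡ-unique x (ι n) z≈0)

  z-1≉0 : ¬ z - 1# ≈ 0#
  z-1≉0 z-1≈0 = x≉1-n (trans (sym (//-rightDividesʳ (ι n) x)) (+-congʳ (x∙y⁻¹≈ε⇒x≈y z 1# z-1≈0)))

  numerator-shift : ι n * z - z + 1# ≈ ι n * ι n + ι n′ * (x - 1#)
  numerator-shift = solve 2 (λ x n′ → let n = I :+ n′ in
    n :* (x :+ n) :- (x :+ n) :+ I := n :* n :+ n′ :* (x :- I)) refl x (ι n′)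
    where I = con (+ 1)
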